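{- Let $k\geq1$ and let $\Pi=\langle I_n:n<\omega\rangle$ be a partition of $\omega$ into finite intervals with $I_n<I_{n+1}$. (1) If $\mathcal{R}_1,\dots,\mathcal{R}_k$ are pairwise non-nearly-coherent ultrafilters over $\omega$, then there are $X_i\in\mathcal{R}_i$ ($i=1,\dots,k$) such that for $i\neq j$, $X_i$ and $X_j$ do not meet the same interval of $\Pi$ and do not meet adjacent intervals of $\Pi$ (i.e. there is no $n$ with $X_i\cap I_n\neq\emptyset$ and $X_j\cap(I_{n-1}\cup I_n\cup I_{n+1})\neq\emptyset$). (2) If $\mathcal{R}_1,\dots,\mathcal{R}_k$ are pairwise non-nearly-coherent Q-points, then there are $X^0_i\in\mathcal{R}_i$ such that each $X^0_i$ meets each interval of $\Pi$ in at most one point and for $i\neq j$, $X^0_i$ and $X^0_j$ do not meet the same interval nor adjacent intervals of $\Pi$.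
   Context: Ultrafilters are non-principal. Filters $\mathcal{F},\mathcal{G}$ over $\omega$ are nearly coherent if there is a finite-to-one $f\colon\omega\to\omega$ with $\{X:f^{ -1}[X]\in\mathcal{F}\}\cup\{X:f^{ -1}[X]\in\mathcal{G}\}$ generating a filter. A Q-point is an ultrafilter $\mathcal{W}$ such that for every interval partition of $\omega$ into finite intervals there is $X\in\mathcal{W}$ meeting each interval in at most one point. -}

module Defs where

open import Level using (0ℓ)
open import Data.Nat using (ℕ; zero; suc; _≤_; _<_)
open import Data.Fin using (Fin)
open import Data.Product using (Σ; ∃; _×_)
open import Data.Sum using (_⊎_)
open import Data.List using (List)
open import Data.List.Relation.Unary.All using (All)
open import Relation.Nullary using (¬_)
open import Relation.Binary.PropositionalEquality using (_≡_; _≢_)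
open import Relation.Unary using (Pred; _∈_; _⊆_; _∩_; ∅; ∁)
open import Function.Bundles using (_⇔_)

Subset : Set₁
Subset = Pred ℕ 0ℓ

Family : Set₁
Family = Pred Subset 0ℓ

record Ultrafilter : Set₁ where
  field
    mem      : Family
    upward   : ∀ {X Y : Subset} → mem X → X ⊆ Y → mem Y
    inter    : ∀ {X Y : Subset} → mem X → mem Y → mem (X ∩ Y)
    proper   : ¬ mem ∅
    ultra    : ∀ (X : Subset) → mem X ⊎ mem (∁ X)
    nonPrincipal : ∀ (n : ℕ) → ¬ (∀ (X : Subset) → mem X ⇔ (n ∈ X))
open Ultrafilter public

FiniteToOne : (ℕ → ℕ) → Set
FiniteToOne f = ∀ (m : ℕ) → ∃ λ (N : ℕ) → ∀ (n : ℕ) → f n ≡ m → n < N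

image : (ℕ → ℕ) → Family → Family
image f 𝓕 X = 𝓕 (λ n → X (f n))

_∪F_ : Family → Family → Family
(𝓐 ∪F 𝓑) X = 𝓐 X ⊎ 𝓑 X

GeneratesFilter : Family → Set₁
GeneratesFilter 𝓐 =
  ∀ (L : List Subset) → All 𝓐 L → ∃ λ (n : ℕ) → All (λ X → X n) L

NearlyCoherent : Family → Family → Set₁
NearlyCoherent 𝓕 𝓖 =
  Σ (ℕ → ℕ) λ f → FiniteToOne f × GeneratesFilter (image f 𝓕 ∪F image f 𝓖)

-- Interval partition of ω: I n = [ a n , a (n+1) ), with a 0 = 0 and a strictly increasing.
record IntervalPartition : Set where
  field
    a     : ℕ → ℕ
    a0    : a 0 ≡ 0
    incr  : ∀ (n : ℕ) → a n < a (suc n)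
open IntervalPartition public

InI : IntervalPartition → ℕ → ℕ → Set
InI Π n x = a Π n ≤ x × x < a Π (suc n)

QPoint : Ultrafilter → Set₁
QPoint W = ∀ (Π : IntervalPartition) → Σ Subset λ X → mem W X ×
  (∀ (n x y : ℕ) → X x → X y → InI Π n x → InI Π n y → x ≡ y)

Meets : IntervalPartition → Subset → ℕ → Set
Meets Π X n = ∃ λ (x : ℕ) → X x × InI Π n x

AtMostOnePerInterval : IntervalPartition → Subset → Set
AtMostOnePerInterval Π X =
  ∀ (n x y : ℕ) → X x → X y → InI Π n x → InI Π n y → x ≡ y

NotSameNorAdjacent : IntervalPartition → Subset → Subset → Set
NotSameNorAdjacent Π X Y =
  ∀ (n m : ℕ) → Meets Π X n → Meets Π Y m → ¬ (suc m ≡ n ⊎ m ≡ n ⊎ m ≡ suc n)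

PairwiseNonNearlyCoherent : (k : ℕ) → (Fin k → Ultrafilter) → Set₁
PairwiseNonNearlyCoherent k R =
  ∀ (i j : Fin k) → i ≢ j → ¬ NearlyCoherent (mem (R i)) (mem (R j))

-- If R i and R j are not nearly coherent and h is finite-to-one, some S has
-- h⁻¹[S] ∈ R i and h⁻¹[ω ∖ S] ∈ R j: otherwise the h-images of R i and R j
-- would generate a filter. Use the two finite-to-one maps sending x ∈ I n to
-- ⌊n/2⌋ and to ⌈n/2⌉; equal or adjacent indices agree under one of them. Let
-- X i be the intersection, over j ≠ i and both maps, of the R i-sides of the
-- separators; points of X i and X j in equal or adjacent intervals would then
-- lie on both sides of one separator. For Q-points, shrink each X i further to
-- a set meeting every interval at most once.
module Submission where

open import Defs
open import Axiom.ExcludedMiddle using (ExcludedMiddle)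
open import Level using (0ℓ)
open import Data.Nat using (ℕ; zero; suc; _+_; _≤_; _<_; z≤n; s≤s; _<?_; ⌊_/2⌋; ⌈_/2⌉)
open import Data.Nat.Properties
open import Data.Fin using (Fin; zero; suc) renaming (_≟_ to _≟ᶠ_)
open import Data.Bool using (Bool; true; false)
open import Data.Unit using (⊤; tt)
open import Data.Empty using (⊥; ⊥-elim)
open import Data.Product using (Σ; ∃; _×_; _,_; proj₁; proj₂)
open import Data.Sum as Sum using (_⊎_; inj₁; inj₂)
open import Data.List using (List; []; _∷_)
open import Data.List.Relation.Unary.All using (All; []; _∷_)
open import Function using (_∘_)
open import Relation.Nullary using (Dec; yes; no; ¬_; does)
open import Relation.Nullary.Decidable using (dec-true; dec-false; decidable-stable)
open import Relation.Binary.PropositionalEquality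
  using (_≡_; _≢_; refl; sym; cong; ≢-sym; module ≡-Reasoning)
open import Relation.Unary using (∅; _⊆_)

mem-⊤ : (U : Ultrafilter) → mem U (λ _ → ⊤)
mem-⊤ U with ultra U ∅
... | inj₁ ∅∈U = ⊥-elim (proper U ∅∈U)
... | inj₂ ∁∅∈U = upward U ∁∅∈U (λ _ → tt)

mem-∀Fin : (U : Ultrafilter) (n : ℕ) (F : Fin n → Subset) → (∀ j → mem U (F j)) →
  mem U (λ x → ∀ j → F j x)
mem-∀Fin U zero F _ = upward U (mem-⊤ U) (λ _ ())
mem-∀Fin U (suc n) F F∈U =
  upward U (inter U (F∈U zero) (mem-∀Fin U n (F ∘ suc) (F∈U ∘ suc)))
    (λ { (x∈F₀ , x∈Fₛ) → λ { zero → x∈F₀ ; (suc j) → x∈Fₛ j } })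

mem-∀Bool : (U : Ultrafilter) (F : Bool → Subset) → (∀ r → mem U (F r)) →
  mem U (λ x → ∀ r → F r x)
mem-∀Bool U F F∈U =
  upward U (inter U (F∈U false) (F∈U true)) (λ { (p , q) → λ { false → p ; true → q } })

module _ (em : ExcludedMiddle 0ℓ) {A : Set} (default : A) (P : A → Set) where

  private
    pick : Dec (∃ P) → A
    pick (yes (x , _)) = x
    pick (no _)        = default

    pick-spec : (d : Dec (∃ P)) → ∃ P → P (pick d)
    pick-spec (yes (_ , px)) _ = px
    pick-spec (no ¬∃P)       p = ⊥-elim (¬∃P p)

  ε : A
  ε = pick em

  ε-spec : ∃ P → P ε
  ε-spec = pick-spec em

-- Separators are Bool-valued rather than Subsets so that their existence is a
-- Set, to which excluded middle at level 0ℓ applies.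
Separates : Ultrafilter → Ultrafilter → (ℕ → ℕ) → (ℕ → Bool) → Set
Separates U V f χ = mem U (λ x → χ (f x) ≡ true) × mem V (λ x → χ (f x) ≡ false)

module _ (em : ExcludedMiddle 0ℓ) (U V : Ultrafilter) (f : ℕ → ℕ) where

  private
    𝓟 : Family
    𝓟 = image f (mem U) ∪F image f (mem V)

    meetᵤ meetᵥ : (L : List Subset) → All 𝓟 L → Subset
    meetᵤ []      []             = λ _ → ⊤
    meetᵤ (X ∷ L) (inj₁ _ ∷ ps) = λ t → X t × meetᵤ L ps t
    meetᵤ (X ∷ L) (inj₂ _ ∷ ps) = meetᵤ L ps
    meetᵥ []      []             = λ _ → ⊤
    meetᵥ (X ∷ L) (inj₁ _ ∷ ps) = meetᵥ L ps
    meetᵥ (X ∷ L) (inj₂ _ ∷ ps) = λ t → X t × meetᵥ L ps t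

    meetᵤ-∈ : ∀ L ps → image f (mem U) (meetᵤ L ps)
    meetᵤ-∈ []      []             = mem-⊤ U
    meetᵤ-∈ (X ∷ L) (inj₁ X∈ ∷ ps) = inter U X∈ (meetᵤ-∈ L ps)
    meetᵤ-∈ (X ∷ L) (inj₂ _  ∷ ps) = meetᵤ-∈ L ps

    meetᵥ-∈ : ∀ L ps → image f (mem V) (meetᵥ L ps)
    meetᵥ-∈ []      []             = mem-⊤ V
    meetᵥ-∈ (X ∷ L) (inj₁ _  ∷ ps) = meetᵥ-∈ L ps
    meetᵥ-∈ (X ∷ L) (inj₂ X∈ ∷ ps) = inter V X∈ (meetᵥ-∈ L ps)

    meets⇒All : ∀ L ps {t} → meetᵤ L ps t → meetᵥ L ps t → All (λ X → X t) L
    meets⇒All []      []             _         _         = []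
    meets⇒All (X ∷ L) (inj₁ _ ∷ ps) (Xt , mu) mv        = Xt ∷ meets⇒All L ps mu mv
    meets⇒All (X ∷ L) (inj₂ _ ∷ ps) mu        (Xt , mv) = Xt ∷ meets⇒All L ps mu mv

  -- If the two meets are disjoint, the first one itself separates.
  inseparable⇒generatesFilter : ¬ ∃ (Separates U V f) → GeneratesFilter 𝓟
  inseparable⇒generatesFilter ¬sep L ps with em {∃ λ t → meetᵤ L ps t × meetᵥ L ps t}
  ... | yes (t , mu , mv) = t , meets⇒All L ps mu mv
  ... | no disjoint = ⊥-elim (¬sep (χ , χ-U , χ-V))
    where
    χ : ℕ → Bool
    χ t = does (em {meetᵤ L ps t})

    χ-U : mem U (λ x → χ (f x) ≡ true)
    χ-U = upward U (meetᵤ-∈ L ps) (λ {x} → dec-true (em {meetᵤ L ps (f x)}))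

    χ-V : mem V (λ x → χ (f x) ≡ false)
    χ-V = upward V (meetᵥ-∈ L ps)
      (λ {x} mv → dec-false (em {meetᵤ L ps (f x)}) (λ mu → disjoint (f x , mu , mv)))

  ¬nearlyCoherent⇒separable : FiniteToOne f → ¬ NearlyCoherent (mem U) (mem V) →
    ∃ (Separates U V f)
  ¬nearlyCoherent⇒separable f-fin ¬nc =
    decidable-stable em (λ ¬sep → ¬nc (f , f-fin , inseparable⇒generatesFilter ¬sep))

n≤1+2⌊n/2⌋ : ∀ n → n ≤ suc (⌊ n /2⌋ + ⌊ n /2⌋)
n≤1+2⌊n/2⌋ zero          = z≤n
n≤1+2⌊n/2⌋ (suc zero)    = s≤s z≤n
n≤1+2⌊n/2⌋ (suc (suc n)) rewrite +-suc ⌊ n /2⌋ ⌊ n /2⌋ = s≤s (s≤s (n≤1+2⌊n/2⌋ n))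

⌊n/2⌋-finiteToOne : FiniteToOne ⌊_/2⌋
⌊n/2⌋-finiteToOne m = suc (suc (m + m)) , λ { n refl → s≤s (n≤1+2⌊n/2⌋ n) }

⌈n/2⌉-finiteToOne : FiniteToOne ⌈_/2⌉
⌈n/2⌉-finiteToOne m = suc (m + m) , λ { n refl → s≤s (begin
  n                       ≡⟨ sym (⌊n/2⌋+⌈n/2⌉≡n n) ⟩
  ⌊ n /2⌋ + ⌈ n /2⌉       ≤⟨ +-monoˡ-≤ ⌈ n /2⌉ (⌊n/2⌋≤⌈n/2⌉ n) ⟩
  ⌈ n /2⌉ + ⌈ n /2⌉       ∎) }
  where open ≤-Reasoning

⌊n/2⌋≡⌊1+n/2⌋⊎⌈n/2⌉≡⌈1+n/2⌉ : ∀ n → ⌊ n /2⌋ ≡ ⌊ suc n /2⌋ ⊎ ⌈ n /2⌉ ≡ ⌈ suc n /2⌉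
⌊n/2⌋≡⌊1+n/2⌋⊎⌈n/2⌉≡⌈1+n/2⌉ zero          = inj₁ refl
⌊n/2⌋≡⌊1+n/2⌋⊎⌈n/2⌉≡⌈1+n/2⌉ (suc zero)    = inj₂ refl
⌊n/2⌋≡⌊1+n/2⌋⊎⌈n/2⌉≡⌈1+n/2⌉ (suc (suc n)) =
  Sum.map (cong suc) (cong suc) (⌊n/2⌋≡⌊1+n/2⌋⊎⌈n/2⌉≡⌈1+n/2⌉ n)

half : Bool → ℕ → ℕ
half false = ⌊_/2⌋
half true  = ⌈_/2⌉

half-finiteToOne : ∀ r → FiniteToOne (half r)
half-finiteToOne false = ⌊n/2⌋-finiteToOne
half-finiteToOne true  = ⌈n/2⌉-finiteToOne

Near : ℕ → ℕ → Set
Near n m = suc m ≡ n ⊎ m ≡ n ⊎ m ≡ suc n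

near⇒∃half≡ : ∀ {n m} → Near n m → ∃ λ r → half r n ≡ half r m
near⇒∃half≡ (inj₂ (inj₁ refl)) = false , refl
near⇒∃half≡ {m = m} (inj₁ refl) with ⌊n/2⌋≡⌊1+n/2⌋⊎⌈n/2⌉≡⌈1+n/2⌉ m
... | inj₁ eq = false , sym eq
... | inj₂ eq = true  , sym eq
near⇒∃half≡ {n} (inj₂ (inj₂ refl)) with ⌊n/2⌋≡⌊1+n/2⌋⊎⌈n/2⌉≡⌈1+n/2⌉ n
... | inj₁ eq = false , eq
... | inj₂ eq = true  , eq

module _ (Π : IntervalPartition) where

  a-strictMono : ∀ {m n} → m < n → a Π m < a Π n
  a-strictMono {m} {suc n} m<1+n with m<1+n⇒m<n∨m≡n m<1+n
  ... | inj₁ m<n  = <-trans (a-strictMono m<n) (incr Π n)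
  ... | inj₂ refl = incr Π m

  a-mono : ∀ {m n} → m ≤ n → a Π m ≤ a Π n
  a-mono m≤n with m≤n⇒m<n∨m≡n m≤n
  ... | inj₁ m<n  = <⇒≤ (a-strictMono m<n)
  ... | inj₂ refl = ≤-refl

  InI-≤ : ∀ {n m x} → InI Π n x → InI Π m x → n ≤ m
  InI-≤ {n} {m} (aₙ≤x , _) (_ , x<aₘ₊₁) =
    ≮⇒≥ (λ m<n → <⇒≱ x<aₘ₊₁ (≤-trans (a-mono m<n) aₙ≤x))

  InI-unique : ∀ {n m x} → InI Π n x → InI Π m x → n ≡ m
  InI-unique p q = ≤-antisym (InI-≤ p q) (InI-≤ q p)

  locate : ∀ x → ∃ λ n → InI Π n x
  locate zero = zero , ≤-reflexive (a0 Π) , ≤-<-trans z≤n (incr Π 0)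
  locate (suc x) with locate x
  ... | n , aₙ≤x , x<aₙ₊₁ with suc x <? a Π (suc n)
  ...   | yes 1+x<aₙ₊₁ = n , m≤n⇒m≤1+n aₙ≤x , 1+x<aₙ₊₁
  ...   | no  1+x≮aₙ₊₁ = suc n , ≮⇒≥ 1+x≮aₙ₊₁ , ≤-<-trans x<aₙ₊₁ (incr Π (suc n))

  index : ℕ → ℕ
  index x = proj₁ (locate x)

  index-∈ : ∀ {n x} → InI Π n x → index x ≡ n
  index-∈ = InI-unique (proj₂ (locate _))

  finiteToOne-∘index : ∀ {f} → FiniteToOne f → FiniteToOne (f ∘ index)
  finiteToOne-∘index f-fin m with f-fin m
  ... | N , bound = a Π N , λ x fx≡m →
    <-≤-trans (proj₂ (proj₂ (locate x))) (a-mono (bound (index x) fx≡m))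

  NotSameNorAdjacent-mono : ∀ {X X′ Y Y′ : Subset} → X′ ⊆ X → Y′ ⊆ Y →
    NotSameNorAdjacent Π X Y → NotSameNorAdjacent Π X′ Y′
  NotSameNorAdjacent-mono X′⊆X Y′⊆Y apart n m (x , x∈X′ , x∈Iₙ) (y , y∈Y′ , y∈Iₘ) =
    apart n m (x , X′⊆X x∈X′ , x∈Iₙ) (y , Y′⊆Y y∈Y′ , y∈Iₘ)

module Separation (em : ExcludedMiddle 0ℓ) (Π : IntervalPartition)
  (k : ℕ) (R : Fin k → Ultrafilter) (nnc : PairwiseNonNearlyCoherent k R) where

  coarse : Bool → ℕ → ℕ
  coarse r = half r ∘ index Π

  χ : Fin k → Fin k → Bool → ℕ → Bool
  χ i j r = ε em (λ _ → true) (Separates (R i) (R j) (coarse r))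

  χ-separates : ∀ {i j} → i ≢ j → ∀ r → Separates (R i) (R j) (coarse r) (χ i j r)
  χ-separates {i} {j} i≢j r = ε-spec em _ _
    (¬nearlyCoherent⇒separable em (R i) (R j) (coarse r)
      (finiteToOne-∘index Π (half-finiteToOne r)) (nnc i j i≢j))

  Sides : Fin k → Fin k → Subset
  Sides i j x = ∀ r → χ i j r (coarse r x) ≡ true × χ j i r (coarse r x) ≡ false

  X : Fin k → Subset
  X i x = ∀ j → i ≢ j → Sides i j x

  X-∈ : ∀ i → mem (R i) (X i)
  X-∈ i = mem-∀Fin (R i) k _ Xᵢⱼ-∈
    where
    Xᵢⱼ-∈ : ∀ j → mem (R i) (λ x → i ≢ j → Sides i j x)
    Xᵢⱼ-∈ j with i ≟ᶠ j
    ... | yes i≡j = upward (R i) (mem-⊤ (R i)) (λ _ i≢j → ⊥-elim (i≢j i≡j))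
    ... | no  i≢j = upward (R i) (mem-∀Bool (R i) _ λ r →
                      inter (R i) (proj₁ (χ-separates i≢j r)) (proj₂ (χ-separates (≢-sym i≢j) r)))
                      (λ x∈ _ → x∈)

  X-apart : ∀ i j → i ≢ j → NotSameNorAdjacent Π (X i) (X j)
  X-apart i j i≢j n m (x , x∈Xᵢ , x∈Iₙ) (y , y∈Xⱼ , y∈Iₘ) near = clash (near⇒∃half≡ near)
    where
    true≢false : true ≢ false
    true≢false ()

    clash : (∃ λ r → half r n ≡ half r m) → ⊥
    clash (r , halves≡) = true≢false (begin
      true                  ≡⟨ sym (proj₁ (x∈Xᵢ j i≢j r)) ⟩
      χ i j r (coarse r x)  ≡⟨ cong (χ i j r ∘ half r) (index-∈ Π x∈Iₙ) ⟩
      χ i j r (half r n)    ≡⟨ cong (χ i j r) halves≡ ⟩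
      χ i j r (half r m)    ≡⟨ cong (χ i j r ∘ half r) (index-∈ Π y∈Iₘ) ⟨
      χ i j r (coarse r y)  ≡⟨ proj₂ (y∈Xⱼ i (≢-sym i≢j) r) ⟩
      false                 ∎)
      where open ≡-Reasoning

lemma2p23 : ExcludedMiddle 0ℓ → (k : ℕ) → 1 ≤ k → (Π : IntervalPartition) →
    ((R : Fin k → Ultrafilter) → PairwiseNonNearlyCoherent k R →
    Σ (Fin k → Subset) λ X → (∀ (i : Fin k) → mem (R i) (X i)) ×
    (∀ (i j : Fin k) → i ≢ j → NotSameNorAdjacent Π (X i) (X j)))
    ×
    ((R : Fin k → Ultrafilter) → (∀ (i : Fin k) → QPoint (R i)) → PairwiseNonNearlyCoherent k R →
    Σ (Fin k → Subset) λ X → (∀ (i : Fin k) → mem (R i) (X i)) ×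
    (∀ (i : Fin k) → AtMostOnePerInterval Π (X i)) ×
    (∀ (i j : Fin k) → i ≢ j → NotSameNorAdjacent Π (X i) (X j)))
lemma2p23 em k _ Π = separated , separatedSelectors
  where
  separated : _
  separated R nnc = X , X-∈ , X-apart
    where open Separation em Π k R nnc

  separatedSelectors : _
  separatedSelectors R qpoint nnc =
      (λ i x → X i x × selector i x)
    , (λ i → inter (R i) (X-∈ i) (selector-∈ i))
    , (λ i n x y x∈ y∈ → selector-atMostOne i n x y (proj₂ x∈) (proj₂ y∈))
    , (λ i j i≢j → NotSameNorAdjacent-mono Π proj₁ proj₁ (X-apart i j i≢j))
    where
    open Separation em Π k R nnc
    selector : Fin k → Subset
    selector i = proj₁ (qpoint i Π)
    selector-∈ : ∀ i → mem (R i) (selector i)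
    selector-∈ i = proj₁ (proj₂ (qpoint i Π))
    selector-atMostOne : ∀ i → AtMostOnePerInterval Π (selector i)
    selector-atMostOne i = proj₂ (proj₂ (qpoint i Π))
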